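{- For every integer $\nu\ge0$, writing $\mathcal{F}_\nu(z)=\frac{z(z-1)\cdots(z-\nu+1)}{\nu!}=\sum_{j=0}^\nu\lambda_{j,\nu}z^j$ (with $\mathcal{F}_0=1$), one has $$\sum_{j=0}^{\nu} j!\,|\lambda_{j,\nu}|\le 2^\nu.$$ -}

module Defs where

open import Data.Nat using (ℕ; zero; suc; _!)
open import Data.Nat.Properties using (_!≢0)
open import Data.Integer as ℤ using (ℤ; +_; -_)
open import Data.List using (List; []; _∷_; map; upTo)
open import Data.Rational as ℚ using (ℚ)

-- Polynomials with integer coefficients, as coefficient lists
-- (constant term first).
Poly : Set
Poly = List ℤ

_⊕_ : Poly → Poly → Poly
[] ⊕ q = q
(a ∷ p) ⊕ [] = a ∷ p
(a ∷ p) ⊕ (b ∷ q) = (a ℤ.+ b) ∷ (p ⊕ q)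

mulLin : ℤ → Poly → Poly
mulLin a p = (+ 0 ∷ p) ⊕ map (a ℤ.*_) p

fallPoly : ℕ → Poly
fallPoly zero = + 1 ∷ []
fallPoly (suc n) = mulLin (- (+ n)) (fallPoly n)

coeff : Poly → ℕ → ℤ
coeff [] _ = + 0
coeff (a ∷ p) zero = a
coeff (a ∷ p) (suc j) = coeff p j

lam : ℕ → ℕ → ℚ
lam j ν = ℚ._/_ (coeff (fallPoly ν) j) (ν !) {{ν !≢0}}

sumℚ : List ℚ → ℚ
sumℚ [] = ℚ.0ℚ
sumℚ (x ∷ xs) = x ℚ.+ sumℚ xs

{-# OPTIONS --safe #-}
-- The coefficients of z(z-1)⋯(z-ν+1) are bounded in absolute value by the unsigned
-- Stirling numbers [ν, j], which satisfy [n+1, j+1] = [n, j] + n [n, j+1] and vanish for j > n.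
-- Hence W n = Σ_j j! [n, j] satisfies W (n+1) ≤ (n+1) W n + n W n ≤ 2 (n+1) W n,
-- so W ν ≤ 2^ν ν!, and dividing by ν! gives the bound.
module Submission where

open import Defs
open import Algebra.Bundles using (CommutativeRing)
open import Data.Nat as ℕ using (ℕ; zero; suc; _^_; _!; NonZero)
open import Data.Nat.Properties as ℕ using (_!≢0)
open import Data.Nat.ListAction using (sum)
open import Data.Nat.Tactic.RingSolver using (solve-∀)
open import Data.Integer as ℤ using (ℤ; +_; -_)
import Data.Integer.Properties as ℤ
open import Data.Integer.Tactic.RingSolver using () renaming (solve-∀ to ℤ-solve-∀)
open import Data.List using (List; []; _∷_; map; upTo)
open import Data.List.Properties using (map-applyUpTo; map-upTo; map-cong)
open import Data.Rational using (ℚ; _≤_; _/_; _+_; _*_; ∣_∣; toℚᵘ)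
open import Data.Rational.Properties
open import Data.Rational.Unnormalised as ℚᵘ using (mkℚᵘ; *≡*; *≤*)
import Data.Rational.Unnormalised.Properties as ℚᵘ
open import Function using (_∘_)
open import Relation.Binary.PropositionalEquality
open import Relation.Nullary using (yes; no)
open import Algebra.Properties.CommutativeSemigroup ℕ.+-commutativeSemigroup
  using () renaming (interchange to +-interchange)
open import Algebra.Properties.CommutativeSemigroup
  (CommutativeRing.*-commutativeSemigroup +-*-commutativeRing) using (x∙yz≈y∙xz)

private
  variable
    A : Set

module _ {f g : A → ℕ} where

  sum-map-cong : (∀ x → f x ≡ g x) → ∀ xs → sum (map f xs) ≡ sum (map g xs)
  sum-map-cong f≗g xs = cong sum (map-cong f≗g xs)

  sum-map-mono-≤ : (∀ x → f x ℕ.≤ g x) → ∀ xs → sum (map f xs) ℕ.≤ sum (map g xs)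
  sum-map-mono-≤ f≤g []       = ℕ.z≤n
  sum-map-mono-≤ f≤g (x ∷ xs) = ℕ.+-mono-≤ (f≤g x) (sum-map-mono-≤ f≤g xs)

  sum-map-+ : ∀ xs → sum (map (λ x → f x ℕ.+ g x) xs) ≡ sum (map f xs) ℕ.+ sum (map g xs)
  sum-map-+ []       = refl
  sum-map-+ (x ∷ xs) = trans (cong (f x ℕ.+ g x ℕ.+_) (sum-map-+ xs)) (+-interchange (f x) (g x) _ _)

sum-map-*ˡ : ∀ m (f : A → ℕ) xs → sum (map (λ x → m ℕ.* f x) xs) ≡ m ℕ.* sum (map f xs)
sum-map-*ˡ m f []       = sym (ℕ.*-zeroʳ m)
sum-map-*ˡ m f (x ∷ xs) = trans (cong (m ℕ.* f x ℕ.+_) (sum-map-*ˡ m f xs)) (sym (ℕ.*-distribˡ-+ m (f x) _))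

sum-map-zero : ∀ {f : A → ℕ} → (∀ x → f x ≡ 0) → ∀ xs → sum (map f xs) ≡ 0
sum-map-zero f≗0 []       = refl
sum-map-zero f≗0 (x ∷ xs) = cong₂ ℕ._+_ (f≗0 x) (sum-map-zero f≗0 xs)

sum-map-upTo-suc : ∀ (f : ℕ → ℕ) K → sum (map f (upTo (suc K))) ≡ f 0 ℕ.+ sum (map (f ∘ suc) (upTo K))
sum-map-upTo-suc f K = cong (λ js → f 0 ℕ.+ sum js) (trans (map-applyUpTo suc f K) (sym (map-upTo (f ∘ suc) K)))

stirling₁ : ℕ → ℕ → ℕ
stirling₁ zero    zero    = 1
stirling₁ zero    (suc k) = 0
stirling₁ (suc n) zero    = n ℕ.* stirling₁ n zero
stirling₁ (suc n) (suc k) = stirling₁ n k ℕ.+ n ℕ.* stirling₁ n (suc k)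

stirling₁-vanishes : ∀ {n k} → n ℕ.< k → stirling₁ n k ≡ 0
stirling₁-vanishes {zero}  {suc k} _ = refl
stirling₁-vanishes {suc n} {suc k} (ℕ.s≤s n<k)
  rewrite stirling₁-vanishes n<k | stirling₁-vanishes (ℕ.m<n⇒m<1+n n<k) = ℕ.*-zeroʳ n

-- The factor suc k can be traded for suc n because the term vanishes unless k ≤ n.
suc-!-stirling₁-≤ : ∀ n k → suc k ! ℕ.* stirling₁ n k ℕ.≤ suc n ℕ.* (k ! ℕ.* stirling₁ n k)
suc-!-stirling₁-≤ n k with n ℕ.<? k
... | yes n<k rewrite stirling₁-vanishes n<k | ℕ.*-zeroʳ (suc k !) | ℕ.*-zeroʳ (k !) | ℕ.*-zeroʳ n = ℕ.z≤n
... | no  n≮k = begin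
  suc k ! ℕ.* stirling₁ n k        ≡⟨ ℕ.*-assoc (suc k) (k !) _ ⟩
  suc k ℕ.* (k ! ℕ.* stirling₁ n k) ≤⟨ ℕ.*-monoˡ-≤ _ (ℕ.s≤s (ℕ.≮⇒≥ n≮k)) ⟩
  suc n ℕ.* (k ! ℕ.* stirling₁ n k) ∎
  where open ℕ.≤-Reasoning

factorialStirling₁Sum : ℕ → List ℕ → ℕ
factorialStirling₁Sum n ks = sum (map (λ k → k ! ℕ.* stirling₁ n k) ks)

factorialStirling₁Sum-suc : ∀ n K →
  factorialStirling₁Sum (suc n) (upTo (suc K)) ≡
  sum (map (λ k → suc k ! ℕ.* stirling₁ n k) (upTo K)) ℕ.+ n ℕ.* factorialStirling₁Sum n (upTo (suc K))
factorialStirling₁Sum-suc n K = begin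
  factorialStirling₁Sum (suc n) (upTo (suc K))
    ≡⟨ sum-map-upTo-suc _ K ⟩
  1 ℕ.* (n ℕ.* c₀) ℕ.+ sum (map (λ k → suc k ! ℕ.* (stirling₁ n k ℕ.+ n ℕ.* stirling₁ n (suc k))) ks)
    ≡⟨ cong (1 ℕ.* (n ℕ.* c₀) ℕ.+_) (trans (sum-map-cong (λ k → distrib (suc k !) _ n _) ks) (sum-map-+ ks)) ⟩
  1 ℕ.* (n ℕ.* c₀) ℕ.+ (S ℕ.+ sum (map (λ k → n ℕ.* (suc k ! ℕ.* stirling₁ n (suc k))) ks))
    ≡⟨ cong (λ t → 1 ℕ.* (n ℕ.* c₀) ℕ.+ (S ℕ.+ t)) (sum-map-*ˡ n _ ks) ⟩
  1 ℕ.* (n ℕ.* c₀) ℕ.+ (S ℕ.+ n ℕ.* T)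
    ≡⟨ regroup n c₀ S T ⟩
  S ℕ.+ n ℕ.* (1 ℕ.* c₀ ℕ.+ T)
    ≡⟨ cong (λ t → S ℕ.+ n ℕ.* t) (sym (sum-map-upTo-suc _ K)) ⟩
  S ℕ.+ n ℕ.* factorialStirling₁Sum n (upTo (suc K)) ∎
  where
  open ≡-Reasoning
  ks : List ℕ
  ks = upTo K
  c₀ S T : ℕ
  c₀ = stirling₁ n 0
  S = sum (map (λ k → suc k ! ℕ.* stirling₁ n k) ks)
  T = sum (map (λ k → suc k ! ℕ.* stirling₁ n (suc k)) ks)
  distrib : ∀ f a m b → f ℕ.* (a ℕ.+ m ℕ.* b) ≡ f ℕ.* a ℕ.+ m ℕ.* (f ℕ.* b)
  distrib = solve-∀
  regroup : ∀ m c s t → 1 ℕ.* (m ℕ.* c) ℕ.+ (s ℕ.+ m ℕ.* t) ≡ s ℕ.+ m ℕ.* (1 ℕ.* c ℕ.+ t)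
  regroup = solve-∀

factorialStirling₁Sum-≤ : ∀ n K → factorialStirling₁Sum n (upTo K) ℕ.≤ 2 ^ n ℕ.* n !
factorialStirling₁Sum-≤ zero    zero    = ℕ.z≤n
factorialStirling₁Sum-≤ zero    (suc K) =
  ℕ.≤-reflexive (trans (sum-map-upTo-suc (λ k → k ! ℕ.* stirling₁ 0 k) K) (cong (1 ℕ.+_) (sum-map-zero (λ k → ℕ.*-zeroʳ (suc k !)) (upTo K))))
factorialStirling₁Sum-≤ (suc n) zero    = ℕ.z≤n
factorialStirling₁Sum-≤ (suc n) (suc K) = begin
  factorialStirling₁Sum (suc n) (upTo (suc K))
    ≡⟨ factorialStirling₁Sum-suc n K ⟩
  sum (map (λ k → suc k ! ℕ.* stirling₁ n k) (upTo K)) ℕ.+ n ℕ.* factorialStirling₁Sum n (upTo (suc K))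
    ≤⟨ ℕ.+-mono-≤ shifted (ℕ.*-monoʳ-≤ n (factorialStirling₁Sum-≤ n (suc K))) ⟩
  suc n ℕ.* B ℕ.+ n ℕ.* B
    ≤⟨ ℕ.+-monoʳ-≤ (suc n ℕ.* B) (ℕ.*-monoˡ-≤ B (ℕ.n≤1+n n)) ⟩
  suc n ℕ.* B ℕ.+ suc n ℕ.* B
    ≡⟨ double (suc n) (2 ^ n) (n !) ⟩
  2 ^ suc n ℕ.* suc n ! ∎
  where
  open ℕ.≤-Reasoning
  B : ℕ
  B = 2 ^ n ℕ.* n !
  shifted : sum (map (λ k → suc k ! ℕ.* stirling₁ n k) (upTo K)) ℕ.≤ suc n ℕ.* B
  shifted = begin
    sum (map (λ k → suc k ! ℕ.* stirling₁ n k) (upTo K))   ≤⟨ sum-map-mono-≤ (suc-!-stirling₁-≤ n) (upTo K) ⟩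
    sum (map (λ k → suc n ℕ.* (k ! ℕ.* stirling₁ n k)) (upTo K)) ≡⟨ sum-map-*ˡ (suc n) _ (upTo K) ⟩
    suc n ℕ.* factorialStirling₁Sum n (upTo K)                ≤⟨ ℕ.*-monoʳ-≤ (suc n) (factorialStirling₁Sum-≤ n K) ⟩
    suc n ℕ.* B                                               ∎
  double : ∀ m p f → m ℕ.* (p ℕ.* f) ℕ.+ m ℕ.* (p ℕ.* f) ≡ (2 ℕ.* p) ℕ.* (m ℕ.* f)
  double = solve-∀

coeff-⊕ : ∀ p q j → coeff (p ⊕ q) j ≡ coeff p j ℤ.+ coeff q j
coeff-⊕ []      q       j       = sym (ℤ.+-identityˡ (coeff q j))
coeff-⊕ (a ∷ p) []      j       = sym (ℤ.+-identityʳ (coeff (a ∷ p) j))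
coeff-⊕ (a ∷ p) (b ∷ q) zero    = refl
coeff-⊕ (a ∷ p) (b ∷ q) (suc j) = coeff-⊕ p q j

coeff-map-*ˡ : ∀ a p j → coeff (map (a ℤ.*_) p) j ≡ a ℤ.* coeff p j
coeff-map-*ˡ a []      j       = sym (ℤ.*-zeroʳ a)
coeff-map-*ˡ a (x ∷ p) zero    = refl
coeff-map-*ˡ a (x ∷ p) (suc j) = coeff-map-*ˡ a p j

coeff-mulLin-zero : ∀ a p → coeff (mulLin a p) 0 ≡ a ℤ.* coeff p 0
coeff-mulLin-zero a p = trans (coeff-⊕ (+ 0 ∷ p) (map (a ℤ.*_) p) 0) (trans (ℤ.+-identityˡ _) (coeff-map-*ˡ a p 0))

coeff-mulLin-suc : ∀ a p j → coeff (mulLin a p) (suc j) ≡ coeff p j ℤ.+ a ℤ.* coeff p (suc j)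
coeff-mulLin-suc a p j = trans (coeff-⊕ (+ 0 ∷ p) (map (a ℤ.*_) p) (suc j)) (cong (λ x → coeff p j ℤ.+ x) (coeff-map-*ˡ a p (suc j)))

∣-n*i∣≡n*∣i∣ : ∀ n i → ℤ.∣ - (+ n) ℤ.* i ∣ ≡ n ℕ.* ℤ.∣ i ∣
∣-n*i∣≡n*∣i∣ n i = trans (ℤ.abs-* (- (+ n)) i) (cong (ℕ._* ℤ.∣ i ∣) (ℤ.∣-i∣≡∣i∣ (+ n)))

∣coeff-fallPoly∣≤stirling₁ : ∀ n j → ℤ.∣ coeff (fallPoly n) j ∣ ℕ.≤ stirling₁ n j
∣coeff-fallPoly∣≤stirling₁ zero    zero    = ℕ.≤-refl
∣coeff-fallPoly∣≤stirling₁ zero    (suc j) = ℕ.≤-refl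
∣coeff-fallPoly∣≤stirling₁ (suc n) zero    = begin
  ℤ.∣ coeff (fallPoly (suc n)) 0 ∣             ≡⟨ cong ℤ.∣_∣ (coeff-mulLin-zero (- (+ n)) (fallPoly n)) ⟩
  ℤ.∣ - (+ n) ℤ.* coeff (fallPoly n) 0 ∣       ≡⟨ ∣-n*i∣≡n*∣i∣ n _ ⟩
  n ℕ.* ℤ.∣ coeff (fallPoly n) 0 ∣             ≤⟨ ℕ.*-monoʳ-≤ n (∣coeff-fallPoly∣≤stirling₁ n 0) ⟩
  n ℕ.* stirling₁ n 0                          ∎
  where open ℕ.≤-Reasoning
∣coeff-fallPoly∣≤stirling₁ (suc n) (suc j) = begin
  ℤ.∣ coeff (fallPoly (suc n)) (suc j) ∣                             ≡⟨ cong ℤ.∣_∣ (coeff-mulLin-suc (- (+ n)) (fallPoly n) j) ⟩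
  ℤ.∣ coeff (fallPoly n) j ℤ.+ - (+ n) ℤ.* coeff (fallPoly n) (suc j) ∣ ≤⟨ ℤ.∣i+j∣≤∣i∣+∣j∣ (coeff (fallPoly n) j) _ ⟩
  ℤ.∣ coeff (fallPoly n) j ∣ ℕ.+ ℤ.∣ - (+ n) ℤ.* coeff (fallPoly n) (suc j) ∣
    ≡⟨ cong (ℤ.∣ coeff (fallPoly n) j ∣ ℕ.+_) (∣-n*i∣≡n*∣i∣ n _) ⟩
  ℤ.∣ coeff (fallPoly n) j ∣ ℕ.+ n ℕ.* ℤ.∣ coeff (fallPoly n) (suc j) ∣
    ≤⟨ ℕ.+-mono-≤ (∣coeff-fallPoly∣≤stirling₁ n j) (ℕ.*-monoʳ-≤ n (∣coeff-fallPoly∣≤stirling₁ n (suc j))) ⟩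
  stirling₁ (suc n) (suc j)                                          ∎
  where open ℕ.≤-Reasoning

fromℕ : ℕ → ℚ
fromℕ n = + n / 1

toℚᵘ-/ : ∀ i d → toℚᵘ (i / suc d) ℚᵘ.≃ mkℚᵘ i d
toℚᵘ-/ i d = toℚᵘ-fromℚᵘ (mkℚᵘ i d)

fromℕ-+ : ∀ m n → fromℕ m + fromℕ n ≡ fromℕ (m ℕ.+ n)
fromℕ-+ m n = toℚᵘ-injective (begin-equality
  toℚᵘ (fromℕ m + fromℕ n)                   ≃⟨ toℚᵘ-homo-+ (fromℕ m) (fromℕ n) ⟩
  toℚᵘ (fromℕ m) ℚᵘ.+ toℚᵘ (fromℕ n)         ≃⟨ ℚᵘ.+-cong (toℚᵘ-/ (+ m) 0) (toℚᵘ-/ (+ n) 0) ⟩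
  mkℚᵘ (+ m) 0 ℚᵘ.+ mkℚᵘ (+ n) 0             ≃⟨ *≡* (cong₂ ℤ._*_ (cong₂ ℤ._+_ (ℤ.*-identityʳ (+ m)) (ℤ.*-identityʳ (+ n))) refl) ⟩
  mkℚᵘ (+ (m ℕ.+ n)) 0                        ≃⟨ toℚᵘ-/ (+ (m ℕ.+ n)) 0 ⟨
  toℚᵘ (fromℕ (m ℕ.+ n))                      ∎)
  where open ℚᵘ.≤-Reasoning

fromℕ-* : ∀ m n → fromℕ m * fromℕ n ≡ fromℕ (m ℕ.* n)
fromℕ-* m n = toℚᵘ-injective (begin-equality
  toℚᵘ (fromℕ m * fromℕ n)                   ≃⟨ toℚᵘ-homo-* (fromℕ m) (fromℕ n) ⟩
  toℚᵘ (fromℕ m) ℚᵘ.* toℚᵘ (fromℕ n)         ≃⟨ ℚᵘ.*-cong (toℚᵘ-/ (+ m) 0) (toℚᵘ-/ (+ n) 0) ⟩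
  mkℚᵘ (+ m) 0 ℚᵘ.* mkℚᵘ (+ n) 0             ≃⟨ *≡* (cong (ℤ._* + 1) (sym (ℤ.pos-* m n))) ⟩
  mkℚᵘ (+ (m ℕ.* n)) 0                        ≃⟨ toℚᵘ-/ (+ (m ℕ.* n)) 0 ⟨
  toℚᵘ (fromℕ (m ℕ.* n))                      ∎)
  where open ℚᵘ.≤-Reasoning

fromℕ-mono-≤ : ∀ {m n} → m ℕ.≤ n → fromℕ m ≤ fromℕ n
fromℕ-mono-≤ {m} {n} m≤n = toℚᵘ-cancel-≤ (begin
  toℚᵘ (fromℕ m)  ≃⟨ toℚᵘ-/ (+ m) 0 ⟩
  mkℚᵘ (+ m) 0    ≤⟨ *≤* (ℤ.*-monoʳ-≤-nonNeg (+ 1) (ℤ.+≤+ m≤n)) ⟩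
  mkℚᵘ (+ n) 0    ≃⟨ toℚᵘ-/ (+ n) 0 ⟨
  toℚᵘ (fromℕ n)  ∎)
  where open ℚᵘ.≤-Reasoning

fromℕ-*-∣/∣ : ∀ i N .{{_ : NonZero N}} → fromℕ N * ∣ i / N ∣ ≡ fromℕ ℤ.∣ i ∣
fromℕ-*-∣/∣ i (suc d) = toℚᵘ-injective (begin-equality
  toℚᵘ (fromℕ (suc d) * ∣ i / suc d ∣)            ≃⟨ toℚᵘ-homo-* (fromℕ (suc d)) _ ⟩
  toℚᵘ (fromℕ (suc d)) ℚᵘ.* toℚᵘ ∣ i / suc d ∣    ≃⟨ ℚᵘ.*-cong (toℚᵘ-/ (+ suc d) 0) (toℚᵘ-homo-∣-∣ (i / suc d)) ⟩
  mkℚᵘ (+ suc d) 0 ℚᵘ.* ℚᵘ.∣ toℚᵘ (i / suc d) ∣   ≃⟨ ℚᵘ.*-congˡ (ℚᵘ.∣-∣-cong (toℚᵘ-/ i d)) ⟩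
  mkℚᵘ (+ suc d) 0 ℚᵘ.* mkℚᵘ (+ ℤ.∣ i ∣) d        ≃⟨ *≡* (cancel (+ suc d) (+ ℤ.∣ i ∣)) ⟩
  mkℚᵘ (+ ℤ.∣ i ∣) 0                               ≃⟨ toℚᵘ-/ (+ ℤ.∣ i ∣) 0 ⟨
  toℚᵘ (fromℕ ℤ.∣ i ∣)                             ∎)
  where
  open ℚᵘ.≤-Reasoning
  cancel : ∀ n a → n ℤ.* a ℤ.* + 1 ≡ a ℤ.* (+ 1 ℤ.* n)
  cancel = ℤ-solve-∀

sumℚ-map-*ˡ : ∀ r (f : A → ℚ) xs → r * sumℚ (map f xs) ≡ sumℚ (map (λ x → r * f x) xs)
sumℚ-map-*ˡ r f []       = *-zeroʳ r
sumℚ-map-*ˡ r f (x ∷ xs) = trans (*-distribˡ-+ r (f x) _) (cong (λ s → r * f x + s) (sumℚ-map-*ˡ r f xs))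

sumℚ-map-mono-≤ : ∀ {f g : A → ℚ} → (∀ x → f x ≤ g x) → ∀ xs → sumℚ (map f xs) ≤ sumℚ (map g xs)
sumℚ-map-mono-≤ f≤g []       = ≤-refl
sumℚ-map-mono-≤ f≤g (x ∷ xs) = +-mono-≤ (f≤g x) (sumℚ-map-mono-≤ f≤g xs)

sumℚ-map-fromℕ : ∀ (f : A → ℕ) xs → sumℚ (map (fromℕ ∘ f) xs) ≡ fromℕ (sum (map f xs))
sumℚ-map-fromℕ f []       = refl
sumℚ-map-fromℕ f (x ∷ xs) = trans (cong (λ s → fromℕ (f x) + s) (sumℚ-map-fromℕ f xs)) (fromℕ-+ (f x) _)

factorial-*-term-≤ : ∀ ν j → fromℕ (ν !) * (fromℕ (j !) * ∣ lam j ν ∣) ≤ fromℕ (j ! ℕ.* stirling₁ ν j)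
factorial-*-term-≤ ν j = begin
  fromℕ (ν !) * (fromℕ (j !) * ∣ lam j ν ∣)    ≡⟨ x∙yz≈y∙xz (fromℕ (ν !)) (fromℕ (j !)) _ ⟩
  fromℕ (j !) * (fromℕ (ν !) * ∣ lam j ν ∣)    ≡⟨ cong (fromℕ (j !) *_) (fromℕ-*-∣/∣ (coeff (fallPoly ν) j) (ν !) {{ν !≢0}}) ⟩
  fromℕ (j !) * fromℕ ℤ.∣ coeff (fallPoly ν) j ∣ ≡⟨ fromℕ-* (j !) _ ⟩
  fromℕ (j ! ℕ.* ℤ.∣ coeff (fallPoly ν) j ∣)   ≤⟨ fromℕ-mono-≤ (ℕ.*-monoʳ-≤ (j !) (∣coeff-fallPoly∣≤stirling₁ ν j)) ⟩
  fromℕ (j ! ℕ.* stirling₁ ν j)                ∎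
  where open ≤-Reasoning

mainTheorem4 : (ν : ℕ) → sumℚ (map (λ j → (+ (j !) / 1) * ∣ lam j ν ∣) (upTo (suc ν))) ≤ (+ (2 ^ ν) / 1)
mainTheorem4 ν = *-cancelˡ-≤-pos (fromℕ (ν !)) {{normalize-pos (ν !) 1 {{_}} {{ν !≢0}}}} (begin
  fromℕ (ν !) * sumℚ (map term js)                  ≡⟨ sumℚ-map-*ˡ (fromℕ (ν !)) term js ⟩
  sumℚ (map (λ j → fromℕ (ν !) * term j) js)        ≤⟨ sumℚ-map-mono-≤ (factorial-*-term-≤ ν) js ⟩
  sumℚ (map (fromℕ ∘ weighted) js)                  ≡⟨ sumℚ-map-fromℕ weighted js ⟩
  fromℕ (factorialStirling₁Sum ν js)                ≤⟨ fromℕ-mono-≤ (factorialStirling₁Sum-≤ ν (suc ν)) ⟩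
  fromℕ (2 ^ ν ℕ.* ν !)                              ≡⟨ cong fromℕ (ℕ.*-comm (2 ^ ν) (ν !)) ⟩
  fromℕ (ν ! ℕ.* 2 ^ ν)                              ≡⟨ fromℕ-* (ν !) (2 ^ ν) ⟨
  fromℕ (ν !) * fromℕ (2 ^ ν)                        ∎)
  where
  open ≤-Reasoning
  js : List ℕ
  js = upTo (suc ν)
  term : ℕ → ℚ
  term j = fromℕ (j !) * ∣ lam j ν ∣
  weighted : ℕ → ℕ
  weighted j = j ! ℕ.* stirling₁ ν j
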